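{- For every natural number $n>1$ there exists a (finite, simple, connected) graph $G$ with $h_\Delta(G)=n$.
   Context: For a graph $G=(V,E)$ and $S\subseteq V$, the $\Delta$-interval $[S]$ is the set consisting of all vertices of $S$ together with every vertex $v\in V$ adjacent to both $x$ and $y$ for some pair of adjacent vertices $x,y\in S$. A set $S$ is $\Delta$-convex if $[S]=S$, and $\langle S\rangle$ denotes the smallest $\Delta$-convex set containing $S$ ($\langle\emptyset\rangle=\emptyset$). A set $S$ is Helly dependent if $\bigcap_{a\in S}\langle S\setminus\{a\}\rangle\neq\emptyset$ and Helly independent otherwise. The Helly number $h_\Delta(G)$ is the least integer $n\ge0$ such that every $S\subseteq V$ with $|S|>n$ is Helly dependent (equivalently, the maximum size of a Helly independent set). -}

module Defs where

open import Data.Nat using (ℕ; suc; _<_; _≤_)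
open import Data.Bool using (Bool; true; false)
open import Data.Fin using (Fin)
open import Data.Fin.Subset using (Subset; _∈_; _∉_; _⊆_; _-_; ∣_∣)
open import Data.Product using (Σ; ∃; ∃-syntax; _×_; _,_)
open import Data.Sum using (_⊎_)
open import Relation.Binary.PropositionalEquality using (_≡_)
open import Relation.Nullary using (¬_)

record Graph : Set where
  field
    order : ℕ
    adj   : Fin order → Fin order → Bool
    adj-sym   : ∀ x y → adj x y ≡ true → adj y x ≡ true
    adj-irrefl : ∀ x → adj x x ≡ false

open Graph public

module _ (G : Graph) where

  Adj : Fin (order G) → Fin (order G) → Set
  Adj x y = adj G x y ≡ true

  data Reach : Fin (order G) → Fin (order G) → Set where
    here : ∀ {u} → Reach u u
    step : ∀ {u w v} → Adj u w → Reach w v → Reach u v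

  Connected : Set
  Connected = (0 < order G) × (∀ u v → Reach u v)

  InInterval : Subset (order G) → Fin (order G) → Set
  InInterval S v = v ∈ S ⊎
    (∃[ x ] ∃[ y ] (x ∈ S × y ∈ S × Adj x y × Adj v x × Adj v y))

  -- S is Δ-convex iff [S] = S (the inclusion S ⊆ [S] always holds)
  IsConvex : Subset (order G) → Set
  IsConvex S = ∀ v → InInterval S v → v ∈ S

  InHull : Subset (order G) → Fin (order G) → Set
  InHull S v = ∀ (T : Subset (order G)) → S ⊆ T → IsConvex T → v ∈ T

  HellyDependent : Subset (order G) → Set
  HellyDependent S = ∃[ v ] (∀ a → a ∈ S → InHull (S - a) v)

  HellyIndependent : Subset (order G) → Set
  HellyIndependent S = ¬ HellyDependent S

  HellyBound : ℕ → Set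
  HellyBound n = ∀ (S : Subset (order G)) → n < ∣ S ∣ → HellyDependent S

  HellyNumber≡ : ℕ → Set
  HellyNumber≡ n = HellyBound n × (∀ k → HellyBound k → n ≤ k)

-- In a triangle-free graph no vertex is adjacent to both ends of an edge, so
-- every set is Δ-convex and ⟨S⟩ = S.  Hence ⋂_{a ∈ S} ⟨S ∖ {a}⟩ = ⋂_{a ∈ S} (S ∖ {a})
-- is empty for every nonempty S: the whole vertex set is Helly independent,
-- and h_Δ(G) = |V(G)|.  The star K_{1,n-1} is a connected triangle-free graph
-- on n vertices.
module Submission where

open import Defs
open import Data.Nat using (ℕ; suc; _<_; _≤_; s≤s; z≤n)
open import Data.Nat.Properties using (≤⇒≯; ≮⇒≥)
open import Data.Bool using (Bool; true; false)
open import Data.Empty using (⊥; ⊥-elim)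
open import Data.Fin using (Fin; zero; suc)
open import Data.Fin.Subset using (Subset; _∈_; _∉_; _-_; ∣_∣; ⊤)
open import Data.Fin.Subset.Properties using (∣p∣≤n; ∣⊤∣≡n; ∈⊤; p─q⊆p)
open import Data.Product using (∃-syntax; _×_; _,_)
open import Data.Sum using (inj₁; inj₂)
open import Data.Vec using (_∷_)
open import Data.Vec.Base using (there)
open import Relation.Binary.PropositionalEquality using (_≡_; refl; subst)

x∉p-x : ∀ {n} (p : Subset n) (x : Fin n) → x ∉ p - x
x∉p-x (_ ∷ p) zero    ()
x∉p-x (_ ∷ p) (suc x) (there x∈p-x) = x∉p-x p x x∈p-x

module _ (G : Graph) where

  TriangleFree : Set
  TriangleFree = ∀ x y v → Adj G x y → Adj G v x → Adj G v y → ⊥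

  hellyBound-order : HellyBound G (order G)
  hellyBound-order S n<∣S∣ = ⊥-elim (≤⇒≯ (∣p∣≤n S) n<∣S∣)

  independent⇒∣S∣≤bound : ∀ {S k} → HellyIndependent G S → HellyBound G k → ∣ S ∣ ≤ k
  independent⇒∣S∣≤bound indep bound = ≮⇒≥ (λ k<∣S∣ → indep (bound _ k<∣S∣))

  module _ (triangleFree : TriangleFree) where

    triangleFree⇒convex : ∀ S → IsConvex G S
    triangleFree⇒convex S v (inj₁ v∈S) = v∈S
    triangleFree⇒convex S v (inj₂ (x , y , _ , _ , xy , vx , vy)) =
      ⊥-elim (triangleFree x y v xy vx vy)

    triangleFree⇒hull⊆ : ∀ {S v} → InHull G S v → v ∈ S
    triangleFree⇒hull⊆ {S} v∈⟨S⟩ = v∈⟨S⟩ S (λ v∈S → v∈S) (triangleFree⇒convex S)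

    -- The common point v would lie in S ∖ {a} for every a ∈ S, in particular for a = v.
    triangleFree⇒independent : ∀ {S} a → a ∈ S → HellyIndependent G S
    triangleFree⇒independent {S} a a∈S (v , v∈⟨S-a⟩) = x∉p-x S v (triangleFree⇒hull⊆ (v∈⟨S-a⟩ v v∈S))
      where
      v∈S : v ∈ S
      v∈S = p─q⊆p S _ (triangleFree⇒hull⊆ (v∈⟨S-a⟩ a a∈S))

    triangleFree⇒hellyNumber≡order : Fin (order G) → HellyNumber≡ G (order G)
    triangleFree⇒hellyNumber≡order x = hellyBound-order , minimal
      where
      minimal : ∀ k → HellyBound G k → order G ≤ k
      minimal k bound = subst (_≤ k) (∣⊤∣≡n (order G))
        (independent⇒∣S∣≤bound (triangleFree⇒independent x ∈⊤) bound)

star-adj : ∀ {m} → Fin m → Fin m → Bool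
star-adj zero    zero    = false
star-adj zero    (suc _) = true
star-adj (suc _) zero    = true
star-adj (suc _) (suc _) = false

star-adj-sym : ∀ {m} (x y : Fin m) → star-adj x y ≡ true → star-adj y x ≡ true
star-adj-sym zero    (suc _) _ = refl
star-adj-sym (suc _) zero    _ = refl

star-adj-irrefl : ∀ {m} (x : Fin m) → star-adj x x ≡ false
star-adj-irrefl zero    = refl
star-adj-irrefl (suc _) = refl

star : ℕ → Graph
star m = record
  { order      = suc m
  ; adj        = star-adj
  ; adj-sym    = star-adj-sym
  ; adj-irrefl = star-adj-irrefl
  }

star-triangleFree : ∀ m → TriangleFree (star m)
star-triangleFree m zero    zero    _       ()
star-triangleFree m zero    (suc _) zero    _  ()
star-triangleFree m zero    (suc _) (suc _) _  _  ()
star-triangleFree m (suc _) zero    zero    _  _  ()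
star-triangleFree m (suc _) zero    (suc _) _  ()
star-triangleFree m (suc _) (suc _) _       ()

star-connected : ∀ m → Connected (star m)
star-connected m = s≤s z≤n , reach
  where
  reach : ∀ u v → Reach (star m) u v
  reach zero    zero    = here
  reach zero    (suc _) = step refl here
  reach (suc _) zero    = step refl here
  reach (suc _) (suc v) = step {w = zero} refl (reach zero (suc v))

-- The hypothesis 1 < n only excludes n = 0; the one-vertex star also has h_Δ = 1.
proposition1 : ∀ (n : ℕ) → 1 < n → ∃[ G ] (Connected G × HellyNumber≡ G n)
proposition1 (suc m) _ =
  star m , star-connected m , triangleFree⇒hellyNumber≡order (star m) (star-triangleFree m) zero
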